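{- Let $G$ be a graph and $t\geq 2$ an integer. If $t=2$ or $G$ is contractible, then the suspension $S_tG$ is contractible.
   Context: All graphs are simple, connected and undirected. A graph map is a function between vertex sets sending equal-or-adjacent vertices to equal-or-adjacent vertices. $I_m$ is the path graph on $\{0,\dots,m\}$ and $\times$ is the Cartesian product of graphs. For $t\ge2$, the suspension $S_tG$ is the graph obtained from $G\times I_t$ by contracting $G\times\{0\}$ to a single vertex and $G\times\{t\}$ to a single vertex. Two graph maps $f,g:G_1\to G_2$ are homotopic if there is a graph map $h:G_1\times I_m\to G_2$ (some $m$) with $h(-,0)=f$, $h(-,m)=g$. A contraction of $G$ is a homotopy from the identity map of $G$ to a constant map; $G$ is contractible if it admits a contraction. -}

module Defs where

open import Data.Nat using (ℕ; zero; suc; _∸_)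
open import Data.Fin using (Fin; toℕ)
open import Data.Product using (Σ; _×_; _,_; ∃)
open import Data.Sum using (_⊎_)
open import Data.Empty using (⊥)
open import Relation.Nullary using (¬_)
open import Relation.Binary.PropositionalEquality using (_≡_)

record RawGraph : Set₁ where
  field
    V   : Set
    _~_ : V → V → Set
open RawGraph public

data Reach (G : RawGraph) : V G → V G → Set where
  here : ∀ {x} → Reach G x x
  step : ∀ {x y z} → _~_ G x y → Reach G y z → Reach G x z

record Graph : Set₁ where
  field
    raw       : RawGraph
    ~-sym     : ∀ {x y} → _~_ raw x y → _~_ raw y x
    ~-irrefl  : ∀ {x} → ¬ (_~_ raw x x)
    point     : V raw
    connected : ∀ x y → Reach raw x y
open Graph public

EqOrAdj : (G : RawGraph) → V G → V G → Set
EqOrAdj G x y = (x ≡ y) ⊎ (_~_ G x y)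

IsGraphMap : (G H : RawGraph) → (V G → V H) → Set
IsGraphMap G H f = ∀ x y → EqOrAdj G x y → EqOrAdj H (f x) (f y)

I : ℕ → RawGraph
I m = record { V = Fin (suc m)
             ; _~_ = λ i j → (toℕ j ≡ suc (toℕ i)) ⊎ (toℕ i ≡ suc (toℕ j)) }

_□_ : RawGraph → RawGraph → RawGraph
G □ H = record { V = V G × V H
               ; _~_ = λ { (a , b) (a' , b') →
                          (_~_ G a a' × b ≡ b') ⊎ (a ≡ a' × _~_ H b b') } }

Homotopic : (G H : RawGraph) → (V G → V H) → (V G → V H) → Set
Homotopic G H f g =
  Σ ℕ λ m → Σ (V G × Fin (suc m) → V H) λ h →
    IsGraphMap (G □ I m) H h
    × (∀ x → h (x , Fin.zero) ≡ f x)
    × (∀ x → h (x , Data.Fin.fromℕ m) ≡ g x)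

Contractible : RawGraph → Set
Contractible G = Σ (V G) λ v → Homotopic G G (λ x → x) (λ _ → v)

-- Suspension S_t G: the quotient of G × I_t collapsing G×{0} to `bot`
-- and G×{t} to `top`.  Vertex (v , i) with 1 ≤ i ≤ t-1 is `mid v k`
-- with k : Fin (t ∸ 1) and i = suc (toℕ k).
data SuspV (A : Set) (t : ℕ) : Set where
  bot : SuspV A t
  top : SuspV A t
  mid : A → Fin (t ∸ 1) → SuspV A t

module _ (G : RawGraph) (t : ℕ) where
  SuspAdj : SuspV (V G) t → SuspV (V G) t → Set
  SuspAdj bot bot = ⊥
  SuspAdj bot top = ⊥
  SuspAdj bot (mid w l) = toℕ l ≡ 0
  SuspAdj top bot = ⊥
  SuspAdj top top = ⊥
  SuspAdj top (mid w l) = suc (toℕ l) ≡ t ∸ 1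
  SuspAdj (mid v k) bot = toℕ k ≡ 0
  SuspAdj (mid v k) top = suc (toℕ k) ≡ t ∸ 1
  SuspAdj (mid v k) (mid w l) =
    (v ≡ w × ((toℕ l ≡ suc (toℕ k)) ⊎ (toℕ k ≡ suc (toℕ l))))
    ⊎ (k ≡ l × _~_ G v w)

S : ℕ → Graph → RawGraph
S t G = record { V = SuspV (V (raw G)) t ; _~_ = SuspAdj (raw G) t }

{-# OPTIONS --safe #-}
module Submission where

-- Lowering all vertices of S_t G one level per step is a homotopy to the bottom vertex,
-- except that once the top vertex moves down it needs a G-coordinate, and its former
-- neighbours stay adjacent to it only if they carry that same coordinate. If G contracts
-- to c, applying the contraction levelwise first moves every vertex into the column over c,
-- a copy of I_t, where lowering is harmless. For t = 2 a single lowering step already sends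
-- the whole middle level to the bottom vertex and the top into the column over any vertex,
-- so no contraction is needed.

open import Defs
open import Data.Nat using (ℕ; zero; suc; _+_; _∸_; _≤_; z≤n; s≤s)
open import Data.Nat.Properties using (1+n≰n; ≤-refl; ≤-trans; m∸n≤m; m≤n⇒m∸n≡0; 0∸n≡0)
open import Data.Fin using (Fin; zero; suc; toℕ; fromℕ; inject₁)
open import Data.Fin.Properties using (toℕ-fromℕ; toℕ-inject₁; toℕ<n)
open import Data.Fin.Relation.Unary.Top using (View; view; ‵fromℕ; ‵inj₁; view-fromℕ; view-inject₁)
open import Data.Sum using (_⊎_; inj₁; inj₂) renaming (map to ⊎-map; map₂ to ⊎-map₂)
open import Data.Product using (_,_)
open import Data.Empty using (⊥-elim)
open import Function using (_∘_; id)
open import Relation.Binary.Definitions using (Symmetric)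
open import Relation.Binary.PropositionalEquality
  using (_≡_; refl; sym; trans; cong; subst; _≗_)

EqOrAdj-sym : ∀ {G} → Symmetric (_~_ G) → Symmetric (EqOrAdj G)
EqOrAdj-sym sym~ (inj₁ x≡y) = inj₁ (sym x≡y)
EqOrAdj-sym sym~ (inj₂ x~y) = inj₂ (sym~ x~y)

∘-isGraphMap : ∀ {G H K g f} → IsGraphMap H K g → IsGraphMap G H f → IsGraphMap G K (g ∘ f)
∘-isGraphMap g-map f-map x y x≈y = g-map _ _ (f-map x y x≈y)

□-horizontal : ∀ {G H x y} (i : V H) → EqOrAdj G x y → EqOrAdj (G □ H) (x , i) (y , i)
□-horizontal i (inj₁ x≡y) = inj₁ (cong (_, i) x≡y)
□-horizontal i (inj₂ x~y) = inj₂ (inj₁ (x~y , refl))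

□-vertical : ∀ {G H i j} (x : V G) → EqOrAdj H i j → EqOrAdj (G □ H) (x , i) (x , j)
□-vertical x (inj₁ i≡j) = inj₁ (cong (x ,_) i≡j)
□-vertical x (inj₂ i~j) = inj₂ (inj₂ (refl , i~j))

Line : RawGraph
Line = record { V = ℕ ; _~_ = λ m n → (n ≡ suc m) ⊎ (m ≡ suc n) }

Line-sym : Symmetric (_~_ Line)
Line-sym (inj₁ n≡1+m) = inj₂ n≡1+m
Line-sym (inj₂ m≡1+n) = inj₁ m≡1+n

successor-isGraphMap : ∀ {H f} → Symmetric (_~_ H) →
  (∀ n → EqOrAdj H (f n) (f (suc n))) → IsGraphMap Line H f
successor-isGraphMap sym~ next n .n (inj₁ refl) = inj₁ refl
successor-isGraphMap sym~ next n .(suc n) (inj₂ (inj₁ refl)) = next n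
successor-isGraphMap {H} sym~ next .(suc m) m (inj₂ (inj₂ refl)) = EqOrAdj-sym {H} sym~ (next m)

suc-∸-adjacent : ∀ n j → EqOrAdj Line (n ∸ j) (suc n ∸ j)
suc-∸-adjacent n       zero    = inj₂ (inj₁ refl)
suc-∸-adjacent zero    (suc j) = inj₁ (sym (0∸n≡0 j))
suc-∸-adjacent (suc n) (suc j) = suc-∸-adjacent n j

∸-suc-adjacent : ∀ n j → EqOrAdj Line (n ∸ j) (n ∸ suc j)
∸-suc-adjacent zero    j       = inj₁ (0∸n≡0 j)
∸-suc-adjacent (suc n) zero    = inj₂ (inj₂ refl)
∸-suc-adjacent (suc n) (suc j) = ∸-suc-adjacent n j

∸-isGraphMap : ∀ j → IsGraphMap Line Line (_∸ j)
∸-isGraphMap j = successor-isGraphMap {Line} Line-sym (λ n → suc-∸-adjacent n j)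

clamp : (m n : ℕ) → Fin (suc m)
clamp zero    n       = zero
clamp (suc m) zero    = zero
clamp (suc m) (suc n) = suc (clamp m n)

clamp-toℕ : ∀ m (i : Fin (suc m)) → clamp m (toℕ i) ≡ i
clamp-toℕ zero    zero    = refl
clamp-toℕ (suc m) zero    = refl
clamp-toℕ (suc m) (suc i) = cong suc (clamp-toℕ m i)

clamp-self : ∀ m → clamp m m ≡ fromℕ m
clamp-self m = trans (cong (clamp m) (sym (toℕ-fromℕ m))) (clamp-toℕ m (fromℕ m))

clamp-suc : ∀ m n → clamp m n ≡ clamp m (suc n) ⊎ toℕ (clamp m (suc n)) ≡ suc (toℕ (clamp m n))
clamp-suc zero    n       = inj₁ refl
clamp-suc (suc m) zero    = inj₂ (cong (suc ∘ toℕ) (clamp-toℕ m zero))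
clamp-suc (suc m) (suc n) = ⊎-map (cong suc) (cong suc) (clamp-suc m n)

-- A homotopy presented as a sequence of graph maps indexed by all of ℕ,
-- which makes concatenation free of Fin arithmetic.
record MapPath (G H : RawGraph) (f g : V G → V H) : Set where
  field
    length     : ℕ
    stage      : ℕ → V G → V H
    stage-map  : ∀ n → IsGraphMap G H (stage n)
    stage-step : ∀ n x → EqOrAdj H (stage n x) (stage (suc n) x)
    stage-zero : ∀ x → stage 0 x ≡ f x
    stage-end  : ∀ x → stage length x ≡ g x
open MapPath

module _ {G H : RawGraph} where

  MapPath-resp : ∀ {f f′ g g′} → f ≗ f′ → g ≗ g′ → MapPath G H f g → MapPath G H f′ g′
  MapPath-resp f≗f′ g≗g′ p = record
    { length     = length p
    ; stage      = stage p
    ; stage-map  = stage-map p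
    ; stage-step = stage-step p
    ; stage-zero = λ x → trans (stage-zero p x) (f≗f′ x)
    ; stage-end  = λ x → trans (stage-end p x) (g≗g′ x)
    }

  adjacent⇒path : ∀ {f g} → IsGraphMap G H f → IsGraphMap G H g →
    (∀ x → EqOrAdj H (f x) (g x)) → MapPath G H f g
  adjacent⇒path {f} {g} f-map g-map f≈g = record
    { length     = 1
    ; stage      = stages
    ; stage-map  = λ { zero → f-map ; (suc _) → g-map }
    ; stage-step = λ { zero → f≈g ; (suc _) x → inj₁ refl }
    ; stage-zero = λ x → refl
    ; stage-end  = λ x → refl
    }
    where
      stages : ℕ → V G → V H
      stages zero    = f
      stages (suc _) = g

  homotopic⇒path : ∀ {f g} → Homotopic G H f g → MapPath G H f g
  homotopic⇒path (m , h , h-map , h-zero , h-end) = record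
    { length     = m
    ; stage      = λ n x → h (x , clamp m n)
    ; stage-map  = λ n x y x≈y → h-map _ _ (□-horizontal {G} {I m} (clamp m n) x≈y)
    ; stage-step = λ n x → h-map _ _ (□-vertical {G} {I m} x (⊎-map₂ inj₁ (clamp-suc m n)))
    ; stage-zero = λ x → trans (cong (λ i → h (x , i)) (clamp-toℕ m zero)) (h-zero x)
    ; stage-end  = λ x → trans (cong (λ i → h (x , i)) (clamp-self m)) (h-end x)
    }

  path⇒homotopic : ∀ {f g} → Symmetric (_~_ H) → MapPath G H f g → Homotopic G H f g
  path⇒homotopic {g = g} sym~ p = length p , h , h-map , stage-zero p , h-end
    where
      h : V (G □ I (length p)) → V H
      h (x , i) = stage p (toℕ i) x

      step-to : ∀ {m n} x → n ≡ suc m → EqOrAdj H (stage p m x) (stage p n x)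
      step-to {m} x refl = stage-step p m x

      h-map : IsGraphMap (G □ I (length p)) H h
      h-map _ _ (inj₁ refl) = inj₁ refl
      h-map (x , i) (y , .i) (inj₂ (inj₁ (x~y , refl))) = stage-map p (toℕ i) x y (inj₂ x~y)
      h-map (x , i) (.x , j) (inj₂ (inj₂ (refl , inj₁ j≡1+i))) = step-to x j≡1+i
      h-map (x , i) (.x , j) (inj₂ (inj₂ (refl , inj₂ i≡1+j))) =
        EqOrAdj-sym {H} sym~ (step-to x i≡1+j)

      h-end : ∀ x → h (x , fromℕ (length p)) ≡ g x
      h-end x = trans (cong (λ n → stage p n x) (toℕ-fromℕ (length p))) (stage-end p x)

  private
    Stages : Set
    Stages = ℕ → V G → V H

  joinStages : ℕ → Stages → Stages → Stages
  joinStages zero    α β n       = β n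
  joinStages (suc m) α β zero    = α zero
  joinStages (suc m) α β (suc n) = joinStages m (α ∘ suc) β n

  joinStages-all : (P : (V G → V H) → Set) → ∀ {α β} → (∀ n → P (α n)) → (∀ n → P (β n)) →
    ∀ m n → P (joinStages m α β n)
  joinStages-all P Pα Pβ zero    n       = Pβ n
  joinStages-all P Pα Pβ (suc m) zero    = Pα zero
  joinStages-all P Pα Pβ (suc m) (suc n) = joinStages-all P (Pα ∘ suc) Pβ m n

  joinStages-+ : ∀ m α β n → joinStages m α β (m + n) ≡ β n
  joinStages-+ zero    α β n = refl
  joinStages-+ (suc m) α β n = joinStages-+ m (α ∘ suc) β n

  joinStages-zero : ∀ m {α β} → α m ≗ β zero → joinStages m α β zero ≗ α zero
  joinStages-zero zero    junction   = sym ∘ junction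
  joinStages-zero (suc m) junction x = refl

  joinStages-step : ∀ m {α β} →
    (∀ n x → EqOrAdj H (α n x) (α (suc n) x)) → (∀ n x → EqOrAdj H (β n x) (β (suc n) x)) →
    α m ≗ β zero → ∀ n x → EqOrAdj H (joinStages m α β n x) (joinStages m α β (suc n) x)
  joinStages-step zero    αs βs junction n         = βs n
  joinStages-step (suc m) {α} αs βs junction zero x =
    subst (EqOrAdj H (α zero x)) (sym (joinStages-zero m junction x)) (αs zero x)
  joinStages-step (suc m) αs βs junction (suc n)   = joinStages-step m (αs ∘ suc) βs junction n

  _++_ : ∀ {f g k} → MapPath G H f g → MapPath G H g k → MapPath G H f k
  p ++ q = record
    { length     = length p + length q
    ; stage      = joinStages (length p) (stage p) (stage q)
    ; stage-map  = joinStages-all (IsGraphMap G H) (stage-map p) (stage-map q) (length p)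
    ; stage-step = joinStages-step (length p) (stage-step p) (stage-step q) junction
    ; stage-zero = λ x → trans (joinStages-zero (length p) junction x) (stage-zero p x)
    ; stage-end  = λ x → trans (cong (λ s → s x) (joinStages-+ (length p) (stage p) (stage q) (length q)))
                               (stage-end q x)
    }
    where
      junction : stage p (length p) ≗ stage q zero
      junction x = trans (stage-end p x) (sym (stage-zero q x))

postcompose : ∀ {G H K f g k} → IsGraphMap H K k → MapPath G H f g → MapPath G K (k ∘ f) (k ∘ g)
postcompose {G} {H} {K} {k = k} k-map p = record
  { length     = length p
  ; stage      = λ n → k ∘ stage p n
  ; stage-map  = λ n → ∘-isGraphMap {G} {H} {K} k-map (stage-map p n)
  ; stage-step = λ n x → k-map _ _ (stage-step p n x)
  ; stage-zero = cong k ∘ stage-zero p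
  ; stage-end  = cong k ∘ stage-end p
  }

descend : ∀ {G q} → IsGraphMap G Line q → ∀ m → (∀ x → q x ≤ m) → MapPath G Line q (λ _ → 0)
descend {G} {q} q-map m q≤m = record
  { length     = m
  ; stage      = λ j x → q x ∸ j
  ; stage-map  = λ j → ∘-isGraphMap {G} {Line} {Line} (∸-isGraphMap j) q-map
  ; stage-step = λ j x → ∸-suc-adjacent (q x) j
  ; stage-zero = λ x → refl
  ; stage-end  = λ x → m≤n⇒m∸n≡0 (q≤m x)
  }

suspMap : ∀ {A B t} → (A → B) → SuspV A t → SuspV B t
suspMap f bot       = bot
suspMap f top       = top
suspMap f (mid v k) = mid (f v) k

suspMap-id : ∀ {A t} → suspMap {A} {A} {t} id ≗ id
suspMap-id bot       = refl
suspMap-id top       = refl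
suspMap-id (mid v k) = refl

height : ∀ {A t} → SuspV A t → ℕ
height bot         = 0
height {t = t} top = t
height (mid v k)   = suc (toℕ k)

-- Only t ≥ 1 needs a clause: for t = 0 the type Fin (t ∸ 1) is empty.
top-height : ∀ {t} (l : Fin (t ∸ 1)) → suc (toℕ l) ≡ t ∸ 1 → t ≡ suc (suc (toℕ l))
top-height {suc t} l p = cong suc (sym p)

module _ {G : Graph} {t : ℕ} where

  SuspAdj-sym : Symmetric (SuspAdj (raw G) t)
  SuspAdj-sym {bot}     {mid w l} p = p
  SuspAdj-sym {top}     {mid w l} p = p
  SuspAdj-sym {mid v k} {bot}     p = p
  SuspAdj-sym {mid v k} {top}     p = p
  SuspAdj-sym {mid v k} {mid w l} (inj₁ (v≡w , inj₁ p)) = inj₁ (sym v≡w , inj₂ p)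
  SuspAdj-sym {mid v k} {mid w l} (inj₁ (v≡w , inj₂ p)) = inj₁ (sym v≡w , inj₁ p)
  SuspAdj-sym {mid v k} {mid w l} (inj₂ (k≡l , v~w))   = inj₂ (sym k≡l , ~-sym G v~w)

  mid-horizontal : ∀ {v w} k → EqOrAdj (raw G) v w → EqOrAdj (S t G) (mid v k) (mid w k)
  mid-horizontal k (inj₁ v≡w) = inj₁ (cong (λ a → mid a k) v≡w)
  mid-horizontal k (inj₂ v~w) = inj₂ (inj₂ (refl , v~w))

  height-isGraphMap : IsGraphMap (S t G) Line height
  height-isGraphMap x .x (inj₁ refl) = inj₁ refl
  height-isGraphMap bot (mid w l) (inj₂ p) = inj₂ (inj₁ (cong suc p))
  height-isGraphMap top (mid w l) (inj₂ p) = inj₂ (inj₂ (top-height l p))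
  height-isGraphMap (mid v k) bot (inj₂ p) = inj₂ (inj₂ (cong suc p))
  height-isGraphMap (mid v k) top (inj₂ p) = inj₂ (inj₁ (top-height k p))
  height-isGraphMap (mid v k) (mid w l) (inj₂ (inj₁ (_ , inj₁ p))) = inj₂ (inj₁ (cong suc p))
  height-isGraphMap (mid v k) (mid w l) (inj₂ (inj₁ (_ , inj₂ p))) = inj₂ (inj₂ (cong suc p))
  height-isGraphMap (mid v k) (mid w .k) (inj₂ (inj₂ (refl , _))) = inj₁ refl

  height≤ : (x : SuspV (V (raw G)) t) → height x ≤ t
  height≤ bot       = z≤n
  height≤ top       = ≤-refl
  height≤ (mid v k) = ≤-trans (toℕ<n k) (m∸n≤m t 1)

module _ {G H : Graph} {t : ℕ} where

  suspMap-isGraphMap : ∀ {f} → IsGraphMap (raw G) (raw H) f → IsGraphMap (S t G) (S t H) (suspMap f)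
  suspMap-isGraphMap f-map x .x (inj₁ refl) = inj₁ refl
  suspMap-isGraphMap f-map bot (mid w l) (inj₂ p) = inj₂ p
  suspMap-isGraphMap f-map top (mid w l) (inj₂ p) = inj₂ p
  suspMap-isGraphMap f-map (mid v k) bot (inj₂ p) = inj₂ p
  suspMap-isGraphMap f-map (mid v k) top (inj₂ p) = inj₂ p
  suspMap-isGraphMap f-map (mid v k) (mid .v l) (inj₂ (inj₁ (refl , p))) = inj₂ (inj₁ (refl , p))
  suspMap-isGraphMap f-map (mid v k) (mid w .k) (inj₂ (inj₂ (refl , v~w))) =
    mid-horizontal {H} k (f-map v w (inj₂ v~w))

  suspMap-path : ∀ {f g} → MapPath (raw G) (raw H) f g → MapPath (S t G) (S t H) (suspMap f) (suspMap g)
  suspMap-path p = record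
    { length     = length p
    ; stage      = suspMap ∘ stage p
    ; stage-map  = suspMap-isGraphMap ∘ stage-map p
    ; stage-step = λ n → levelwise (stage-step p n)
    ; stage-zero = suspMap-cong (stage-zero p)
    ; stage-end  = suspMap-cong (stage-end p)
    }
    where
      levelwise : ∀ {f g} → (∀ v → EqOrAdj (raw H) (f v) (g v)) →
        ∀ x → EqOrAdj (S t H) (suspMap f x) (suspMap g x)
      levelwise f≈g bot       = inj₁ refl
      levelwise f≈g top       = inj₁ refl
      levelwise f≈g (mid v k) = mid-horizontal {H} k (f≈g v)

      suspMap-cong : ∀ {f g} → f ≗ g → suspMap {t = t} f ≗ suspMap g
      suspMap-cong f≗g bot       = refl
      suspMap-cong f≗g top       = refl
      suspMap-cong f≗g (mid v k) = cong (λ a → mid a k) (f≗g v)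

module _ {A : Set} {u : ℕ} where

  midOrTop : A → {i : Fin (suc (suc u))} → View i → SuspV A (suc (suc u))
  midOrTop c ‵fromℕ            = top
  midOrTop c (‵inj₁ {i = k} _) = mid c k

  -- The copy of I_t in S_t G lying over c, extended constantly past height t;
  -- the heights 1 … t are read off Fin (suc (suc u)) by its top view.
  column : A → ℕ → SuspV A (suc (suc u))
  column c zero    = bot
  column c (suc n) = midOrTop c (view (clamp (suc u) n))

  column-top : ∀ c → column c (suc (suc u)) ≡ top
  column-top c = trans (cong (midOrTop c ∘ view) (clamp-self (suc u)))
                       (cong (midOrTop c) (view-fromℕ (suc u)))

  column-mid : ∀ c k → column c (suc (toℕ k)) ≡ mid c k
  column-mid c k = trans (cong (midOrTop c ∘ view) clamp-inject₁) (cong (midOrTop c) (view-inject₁ k))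
    where
      clamp-inject₁ : clamp (suc u) (toℕ k) ≡ inject₁ k
      clamp-inject₁ = trans (cong (clamp (suc u)) (sym (toℕ-inject₁ k))) (clamp-toℕ (suc u) (inject₁ k))

  suspMap-const : ∀ c → suspMap (λ (_ : A) → c) ≗ column c ∘ height
  suspMap-const c bot       = refl
  suspMap-const c top       = sym (column-top c)
  suspMap-const c (mid v k) = sym (column-mid c k)

module _ {G : Graph} {u : ℕ} where

  private
    t : ℕ
    t = suc (suc u)

  midOrTop-adjacent : ∀ c {i j} (vi : View i) (vj : View j) → toℕ j ≡ suc (toℕ i) →
    SuspAdj (raw G) t (midOrTop c vi) (midOrTop c vj)
  midOrTop-adjacent c {j = j} ‵fromℕ vj p =
    ⊥-elim (1+n≰n (subst (λ n → suc n ≤ t) (trans p (cong suc (toℕ-fromℕ (suc u)))) (toℕ<n j)))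
  midOrTop-adjacent c (‵inj₁ {i = k} _) ‵fromℕ p =
    trans (cong suc (sym (toℕ-inject₁ k))) (trans (sym p) (toℕ-fromℕ (suc u)))
  midOrTop-adjacent c (‵inj₁ {i = k} _) (‵inj₁ {i = l} _) p =
    inj₁ (refl , inj₁ (trans (sym (toℕ-inject₁ l)) (trans p (cong suc (toℕ-inject₁ k)))))

  column-step : ∀ c n → EqOrAdj (S t G) (column c n) (column c (suc n))
  column-step c zero = inj₂ refl
  column-step c (suc n) with clamp-suc (suc u) n
  ... | inj₁ i≡j = inj₁ (cong (midOrTop c ∘ view) i≡j)
  ... | inj₂ p   = inj₂ (midOrTop-adjacent c (view _) (view _) p)

  column-isGraphMap : ∀ c → IsGraphMap Line (S t G) (column c)
  column-isGraphMap c = successor-isGraphMap {S t G} (SuspAdj-sym {G}) (column-step c)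

  lowered-height-isGraphMap : ∀ d → IsGraphMap (S t G) Line (λ x → height x ∸ d)
  lowered-height-isGraphMap d = ∘-isGraphMap {S t G} {Line} {Line} (∸-isGraphMap d) (height-isGraphMap {G})

  column-descent : ∀ c d → MapPath (S t G) (S t G) (λ x → column c (height x ∸ d)) (λ _ → bot)
  column-descent c d = postcompose (column-isGraphMap c)
    (descend (lowered-height-isGraphMap d) t (λ x → ≤-trans (m∸n≤m (height x) d) (height≤ {G} x)))

S₂-step-down : ∀ {G} c (x : SuspV (V (raw G)) 2) → EqOrAdj (S 2 G) x (column c (height x ∸ 1))
S₂-step-down c bot          = inj₁ refl
S₂-step-down c top          = inj₂ refl
S₂-step-down c (mid v zero) = inj₂ refl

proposition4p4 : (G : Graph) (t : ℕ) → 2 ≤ t →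
    (t ≡ 2) ⊎ Contractible (raw G) → Contractible (S t G)
proposition4p4 G .2 _ (inj₁ refl) =
  bot , path⇒homotopic (SuspAdj-sym {G}) (stepDown ++ column-descent {G} (point G) 1)
  where
    stepDown : MapPath (S 2 G) (S 2 G) id (λ x → column (point G) (height x ∸ 1))
    stepDown = adjacent⇒path (λ _ _ → id)
      (∘-isGraphMap {S 2 G} {Line} {S 2 G} (column-isGraphMap {G} (point G)) (lowered-height-isGraphMap {G} 1))
      (S₂-step-down {G} (point G))
proposition4p4 G (suc (suc u)) (s≤s (s≤s z≤n)) (inj₂ (c , contraction)) =
  bot , path⇒homotopic (SuspAdj-sym {G}) (collapse ++ column-descent {G} c 0)
  where
    collapse : MapPath (S (suc (suc u)) G) (S (suc (suc u)) G) id (column c ∘ height)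
    collapse = MapPath-resp suspMap-id (suspMap-const c) (suspMap-path {G} {G} (homotopic⇒path contraction))
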